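{- Let $\mathcal{F}=(W,\preccurlyeq,V_{\mathcal{F}})$ be a finite poset model. For all $w_1,w_2\in W$: if $w_1$ and $w_2$ are weakly $\pm$-bisimilar, then $w_1\equiv_\eta w_2$.
   Context: $\mathcal{F}$: finite partial order $(W,\preccurlyeq)$ with $V_{\mathcal{F}}:PL\to2^W$. A $\pm$-path of length $\ell\ge2$: $\pi:\{0,\dots,\ell\}\to W$ with $\pi(i)\preccurlyeq\pi(i+1)$ or $\pi(i+1)\preccurlyeq\pi(i)$ for each $i<\ell$, $\pi(0)\preccurlyeq\pi(1)$, $\pi(\ell)\preccurlyeq\pi(\ell-1)$. $\mathrm{SLCS}_\eta$: $\Phi::=p\mid\neg\Phi\mid\Phi_1\wedge\Phi_2\mid\eta(\Phi_1,\Phi_2)$; $w\models p$ iff $w\in V_{\mathcal{F}}(p)$, Boolean connectives standard, $w\models\eta(\Phi_1,\Phi_2)$ iff some $\pm$-path $\pi$ of length $\ell$ with $\pi(0)=w$ has $\pi(\ell)\models\Phi_2$ and $\pi(i)\models\Phi_1$ for all $i<\ell$; $\equiv_\eta$: same formulas. A weak $\pm$-bisimulation is a symmetric $Z\subseteq W\times W$ such that $Z(w_1,w_2)$ implies: (1) $\{p:w_1\in V_{\mathcal{F}}(p)\}=\{p:w_2\in V_{\mathcal{F}}(p)\}$; (2) for all $u_1,d_1\in W$ with ($w_1\preccurlyeq u_1$ or $u_1\preccurlyeq w_1$) and $d_1\preccurlyeq u_1$, there is a $\pm$-path $\pi_2$ of some length $\ell_2$ with $\pi_2(0)=w_2$,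 $Z(d_1,\pi_2(\ell_2))$, and for all $j<\ell_2$, $Z(w_1,\pi_2(j))$ or $Z(u_1,\pi_2(j))$. Weakly $\pm$-bisimilar: related by some weak $\pm$-bisimulation. -}

module Defs where

open import Level using (Level; _⊔_; suc)
open import Data.Nat using (ℕ; _<_; _≤_; _∸_)
open import Data.Fin using (Fin)
open import Data.Product using (Σ; ∃; _×_; _,_)
open import Data.Sum using (_⊎_)
open import Data.Empty using (⊥)
open import Relation.Nullary using (¬_)
open import Relation.Binary.PropositionalEquality using (_≡_)
open import Relation.Binary.Structures using (IsPartialOrder)
open import Function.Bundles using (_↔_; _⇔_)

record PosetModel (PL : Set) : Set₁ where
  field
    W       : Set
    _≼_     : W → W → Set
    isPO    : IsPartialOrder _≡_ _≼_
    size    : ℕ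
    finite  : W ↔ Fin size
    V       : PL → W → Set

data Form (PL : Set) : Set where
  atom : PL → Form PL
  ¬'_  : Form PL → Form PL
  _∧'_ : Form PL → Form PL → Form PL
  η    : Form PL → Form PL → Form PL

module _ {PL : Set} (F : PosetModel PL) where
  open PosetModel F

  -- π : ℕ → W restricted to {0..ℓ} is a ±-path of length ℓ
  IsPMPath : ℕ → (ℕ → W) → Set
  IsPMPath ℓ π =
    (2 ≤ ℓ)
    × (∀ i → i < ℓ → (π i ≼ π (Data.Nat.suc i)) ⊎ (π (Data.Nat.suc i) ≼ π i))
    × (π 0 ≼ π 1)
    × (π ℓ ≼ π (ℓ ∸ 1))

  _⊨_ : W → Form PL → Set
  w ⊨ atom p = V p w
  w ⊨ (¬' Φ) = ¬ (w ⊨ Φ)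
  w ⊨ (Φ₁ ∧' Φ₂) = (w ⊨ Φ₁) × (w ⊨ Φ₂)
  w ⊨ η Φ₁ Φ₂ = Σ ℕ λ ℓ → Σ (ℕ → W) λ π →
    IsPMPath ℓ π × (π 0 ≡ w) × (π ℓ ⊨ Φ₂) × (∀ i → i < ℓ → π i ⊨ Φ₁)

  _≡η_ : W → W → Set
  w₁ ≡η w₂ = ∀ (Φ : Form PL) → (w₁ ⊨ Φ) ⇔ (w₂ ⊨ Φ)

  record IsWeakPMBisim (Z : W → W → Set) : Set₁ where
    field
      symm  : ∀ {w₁ w₂} → Z w₁ w₂ → Z w₂ w₁
      atoms : ∀ {w₁ w₂} → Z w₁ w₂ → ∀ p → V p w₁ ⇔ V p w₂
      zigzag : ∀ {w₁ w₂} → Z w₁ w₂ →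
        ∀ u₁ d₁ → ((w₁ ≼ u₁) ⊎ (u₁ ≼ w₁)) → d₁ ≼ u₁ →
        Σ ℕ λ ℓ₂ → Σ (ℕ → W) λ π₂ →
          IsPMPath ℓ₂ π₂ × (π₂ 0 ≡ w₂) × Z d₁ (π₂ ℓ₂)
          × (∀ j → j < ℓ₂ → Z w₁ (π₂ j) ⊎ Z u₁ (π₂ j))

  WeaklyPMBisimilar : W → W → Set₁
  WeaklyPMBisimilar w₁ w₂ =
    Σ (W → W → Set) λ Z → IsWeakPMBisim Z × Z w₁ w₂

-- Read η(Φ₁, Φ₂) at w as: w satisfies Φ₁ and reaches Φ₂ along a Φ₁-walk whose last
-- step goes down (the initial upward step of a ±-path can always be the trivial w ≼ w).
-- Such down-walks transfer along a weak ±-bisimulation by induction on the walk: each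
-- step is matched by the zigzag clause with u₁ = d₁ the next point, the final downward
-- step by the clause with u₁ the last point before the end and d₁ the end point, and the
-- matching ±-path ends with a downward step again.
module Submission where

open import Defs
open import Data.Nat using (ℕ; zero; suc; _<_; s≤s; z≤n)
open import Data.Nat.Properties using (n<1+n; m<n⇒m<1+n)
open import Data.Product using (Σ; _×_; _,_)
open import Data.Sum using (_⊎_; inj₁; inj₂; [_,_]′; reduce)
open import Function using (_∘_; flip)
open import Function.Bundles using (mk⇔; Equivalence)
open import Relation.Binary.PropositionalEquality using (_≡_; refl; subst)
open import Relation.Binary.Structures using (IsPartialOrder)

module _ {PL : Set} (F : PosetModel PL) where
  open PosetModel F
  open IsPartialOrder isPO using () renaming (refl to ≼-refl)

  Adjacent : W → W → Set
  Adjacent a b = (a ≼ b) ⊎ (b ≼ a)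

  IsWalk : ℕ → (ℕ → W) → Set
  IsWalk ℓ π = ∀ i → i < ℓ → Adjacent (π i) (π (suc i))

  module _ (P₁ P₂ : W → Set) where

    PathUntil : W → Set
    PathUntil w = Σ ℕ λ ℓ → Σ (ℕ → W) λ π →
      IsPMPath F ℓ π × (π 0 ≡ w) × P₂ (π ℓ) × (∀ i → i < ℓ → P₁ (π i))

    data DownWalk : W → Set where
      last : ∀ {v w} → P₁ v → w ≼ v → P₂ w → DownWalk v
      step : ∀ {v w} → P₁ v → Adjacent v w → DownWalk w → DownWalk v

    head : ∀ {v} → DownWalk v → P₁ v
    head (last p₁ _ _) = p₁
    head (step p₁ _ _) = p₁

    -- A walk d visits the points  vertices d 0 , … , vertices d (suc (len d)).
    len : ∀ {v} → DownWalk v → ℕ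
    len (last _ _ _) = 0
    len (step _ _ d) = suc (len d)

    vertices : ∀ {v} → DownWalk v → ℕ → W
    vertices {v} _ zero = v
    vertices (last {w = w} _ _ _) (suc _) = w
    vertices (step _ _ d) (suc i) = vertices d i

    vertices-isWalk : ∀ {v} (d : DownWalk v) → IsWalk (suc (len d)) (vertices d)
    vertices-isWalk (last _ w≼v _) zero _ = inj₂ w≼v
    vertices-isWalk (last _ _ _) (suc _) (s≤s ())
    vertices-isWalk (step _ adj _) zero _ = adj
    vertices-isWalk (step _ _ d) (suc i) (s≤s i<) = vertices-isWalk d i i<

    vertices-down : ∀ {v} (d : DownWalk v) →
      vertices d (suc (len d)) ≼ vertices d (len d)
    vertices-down (last _ w≼v _) = w≼v
    vertices-down (step _ _ d) = vertices-down d

    vertices-goal : ∀ {v} (d : DownWalk v) → P₂ (vertices d (suc (len d)))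
    vertices-goal (last _ _ p₂) = p₂
    vertices-goal (step _ _ d) = vertices-goal d

    vertices-inv : ∀ {v} (d : DownWalk v) → ∀ i → i < suc (len d) → P₁ (vertices d i)
    vertices-inv d zero _ = head d
    vertices-inv (step _ _ d) (suc i) (s≤s i<) = vertices-inv d i i<

    DownWalk-prepend : ∀ ℓ π → IsWalk ℓ π → (∀ i → i < ℓ → P₁ (π i)) →
      DownWalk (π ℓ) → DownWalk (π 0)
    DownWalk-prepend zero π _ _ d = d
    DownWalk-prepend (suc ℓ) π walk inv d =
      step (inv 0 (s≤s z≤n)) (walk 0 (s≤s z≤n))
        (DownWalk-prepend ℓ (π ∘ suc) (λ i → walk (suc i) ∘ s≤s) (λ i → inv (suc i) ∘ s≤s) d)

    PathUntil⇒DownWalk : ∀ {w} → PathUntil w → DownWalk w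
    PathUntil⇒DownWalk (suc ℓ , π , (s≤s _ , walk , _ , down) , refl , p₂ , inv) =
      DownWalk-prepend ℓ π (λ i → walk i ∘ m<n⇒m<1+n) (λ i → inv i ∘ m<n⇒m<1+n)
        (last (inv ℓ (n<1+n ℓ)) down p₂)

    DownWalk⇒PathUntil : ∀ {w} → DownWalk w → PathUntil w
    DownWalk⇒PathUntil d =
      suc (len d′) , vertices d′ ,
      (s≤s (s≤s z≤n) , vertices-isWalk d′ , ≼-refl , vertices-down d′) ,
      refl , vertices-goal d′ , vertices-inv d′
      where d′ = step (head d) (inj₁ ≼-refl) d

  module _ {Z : W → W → Set} (B : IsWeakPMBisim F Z) where
    open IsWeakPMBisim B

    DownWalk-transfer : ∀ {P₁ P₂ : W → Set} →
      (∀ {a b} → Z a b → P₁ a → P₁ b) → (∀ {a b} → Z a b → P₂ a → P₂ b) →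
      ∀ {v v′} → Z v v′ → DownWalk P₁ P₂ v → DownWalk P₁ P₂ v′
    DownWalk-transfer {P₁} {P₂} t₁ t₂ {v} z (last {w = w} p₁ w≼v p₂)
      with zigzag z v w (inj₁ ≼-refl) w≼v
    ... | ℓ , π , path , start , z-end , z-inner =
      PathUntil⇒DownWalk P₁ P₂
        (ℓ , π , path , start , t₂ z-end p₂ , λ i i< → t₁ (reduce (z-inner i i<)) p₁)
    DownWalk-transfer {P₁} {P₂} t₁ t₂ z (step {w = w} p₁ adj d)
      with zigzag z w w adj ≼-refl
    ... | ℓ , π , (_ , walk , _) , refl , z-end , z-inner =
      DownWalk-prepend P₁ P₂ ℓ π walk
        (λ i i< → [ flip t₁ p₁ , flip t₁ (head P₁ P₂ d) ]′ (z-inner i i<))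
        (DownWalk-transfer t₁ t₂ z-end d)

    ⊨-transfer : ∀ Φ {x y} → Z x y → _⊨_ F x Φ → _⊨_ F y Φ
    ⊨-transfer (atom p) z = Equivalence.to (atoms z p)
    ⊨-transfer (¬' Φ) z ¬x⊨Φ = ¬x⊨Φ ∘ ⊨-transfer Φ (symm z)
    ⊨-transfer (Φ₁ ∧' Φ₂) z (x⊨Φ₁ , x⊨Φ₂) = ⊨-transfer Φ₁ z x⊨Φ₁ , ⊨-transfer Φ₂ z x⊨Φ₂
    ⊨-transfer (η Φ₁ Φ₂) z =
      DownWalk⇒PathUntil P₁ P₂
      ∘ DownWalk-transfer (⊨-transfer Φ₁) (⊨-transfer Φ₂) z
      ∘ PathUntil⇒DownWalk P₁ P₂
      where
      P₁ = λ w → _⊨_ F w Φ₁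
      P₂ = λ w → _⊨_ F w Φ₂

lemma4p10 : {PL : Set} (F : PosetModel PL) (w₁ w₂ : PosetModel.W F) →
    WeaklyPMBisimilar F w₁ w₂ → _≡η_ F w₁ w₂
lemma4p10 F w₁ w₂ (Z , B , z) Φ =
  mk⇔ (⊨-transfer F B Φ z) (⊨-transfer F B Φ (IsWeakPMBisim.symm B z))
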